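{- Let $\sigma$ be a signature, $\Delta$ a set of $\mathcal{CO}[\sigma]$-formulas and $\varphi,\psi$ arbitrary $\mathcal{CO}_{\sqcup}[\sigma]$-formulas. If $\Delta\models^g\varphi\sqcup\psi$, then $\Delta\models^g\varphi$ or $\Delta\models^g\psi$. In particular, if $\models^g\varphi\sqcup\psi$, then $\models^g\varphi$ or $\models^g\psi$.
   Context: Signature $\sigma=(\mathrm{Dom},\mathrm{Ran})$: nonempty finite set of variables, each with a nonempty finite range. A system of functions $\mathcal F$ assigns to each $V\in\mathrm{En}(\mathcal F)\subseteq\mathrm{Dom}$ a set $PA_V^{\mathcal F}\subseteq\mathrm{Dom}\setminus\{V\}$ and $\mathcal F_V:\mathrm{Ran}(PA_V^{\mathcal F})\to\mathrm{Ran}(V)$; recursive if the graph with edges $(X,Y)$, $X\in PA_Y^{\mathcal F}$, is acyclic; an assignment $s$ (map with $s(X)\in\mathrm{Ran}(X)$) is compatible with $\mathcal F$ if $s(V)=\mathcal F_V(s(PA_V^{\mathcal F}))$ for $V\in\mathrm{En}(\mathcal F)$. A generalized causal team is a set $T$ of pairs $(s,\mathcal F)$ with $\mathcal F$ recursive and $s$ compatible; subteams are subsets; $T^-=\{s\mid(s,\mathcal F)\in T\}$. $\mathbf X=\mathbf x$: conjunction of equations, consistent if no variable gets two distinct values. Intervention (consistent): $\mathcal F_{\mathbf X=\mathbf x}$ = restriction of $\mathcal F$ to $\mathrm{En}(\mathcal F)\setminus\mathbf X$; $s_{\mathbf X=\mathbf x}(X_i)=x_i$, $s_{\mathbf X=\mathbf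 x}(V)=s(V)$ for $V\notin\mathrm{En}(\mathcal F)\cup\mathbf X$, $s_{\mathbf X=\mathbf x}(V)=\mathcal F_V(s_{\mathbf X=\mathbf x}(PA_V^{\mathcal F}))$ recursively otherwise; $T_{\mathbf X=\mathbf x}=\{(s_{\mathbf X=\mathbf x},\mathcal F_{\mathbf X=\mathbf x})\mid(s,\mathcal F)\in T\}$. $\mathcal{CO}[\sigma]$: $\alpha::=X=x\mid\neg\alpha\mid\alpha\wedge\alpha\mid\alpha\vee\alpha\mid\mathbf X=\mathbf x\ \Box\!\!\rightarrow\alpha$. $\mathcal{CO}_{\sqcup}[\sigma]$: $\varphi::=X=x\mid\neg\alpha\mid\varphi\wedge\varphi\mid\varphi\vee\varphi\mid\varphi\sqcup\varphi\mid\mathbf X=\mathbf x\ \Box\!\!\rightarrow\varphi$ with $\alpha\in\mathcal{CO}[\sigma]$. Generalized semantics $\models^g$: $T\models X=x$ iff $s(X)=x$ for all $s\in T^-$; $T\models\neg\alpha$ iff $\{(s,\mathcal F)\}\not\models\alpha$ for all $(s,\mathcal F)\in T$; $\wedge$ usual; $T\models\varphi\vee\psi$ iff $T=T_1\cup T_2$ with $T_1\models\varphi$, $T_2\models\psi$; $T\models\varphi\sqcup\psi$ iff $T\models\varphi$ or $T\models\psi$; $T\models\mathbf X=\mathbf x\ \Box\!\!\rightarrow\varphi$ iff inconsistent or $T_{\mathbf X=\mathbf x}\models\varphi$. $\Delta\models^g\varphi$: every generalized causal team over $\sigma$ satisfying all of $\Delta$ satisfies $\varphi$; $\models^g\varphi$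 is the case $\Delta=\emptyset$. -}

module Defs where

open import Level using (Level) renaming (suc to lsuc; zero to lzero)
open import Data.Nat using (ℕ; suc)
open import Data.Fin using (Fin; _≟_)
open import Data.Bool using (Bool; true; false; _∧_; not; _∨_)
open import Data.Product using (Σ; ∃; _×_; _,_; proj₁; proj₂)
open import Data.Sum using (_⊎_)
open import Data.Empty using (⊥)
open import Data.List using (List; []; _∷_)
open import Data.List.NonEmpty using (List⁺; toList)
open import Data.List.Membership.Propositional using (_∈_)
open import Relation.Nullary using (¬_; does)
open import Relation.Binary.PropositionalEquality using (_≡_)
open import Relation.Binary.Construct.Closure.Transitive using (TransClosure)

-- Signatures: Dom = Fin (suc nV) (nonempty, finite);
-- Ran X = Fin (suc (rng X)) (nonempty, finite).

record Signature : Set where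
  field
    nV  : ℕ
    rng : Fin (suc nV) → ℕ

module _ (σ : Signature) where
  open Signature σ

  Var : Set
  Var = Fin (suc nV)

  Val : Var → Set
  Val X = Fin (suc (rng X))

  Assignment : Set
  Assignment = (X : Var) → Val X

  AgreeOn : (Var → Bool) → Assignment → Assignment → Set
  AgreeOn P s t = ∀ X → P X ≡ true → s X ≡ t X

  -- En is the set of endogenous variables,
  -- PA V X ≡ true means X ∈ PA_V, and F_V : Ran(PA_V) → Ran(V) is
  -- represented as a function on full assignments depending only on
  -- the values on PA_V.  (PA V / fn V for V ∉ En are irrelevant.)
  record SysFun : Set where
    field
      En       : Var → Bool
      PA       : Var → Var → Bool
      PA-irr   : ∀ V → En V ≡ true → PA V V ≡ false
      fn       : (V : Var) → Assignment → Val V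
      fn-local : ∀ V s t → AgreeOn (PA V) s t → fn V s ≡ fn V t
  open SysFun public

  Edge : SysFun → Var → Var → Set
  Edge F X Y = (En F Y ≡ true) × (PA F Y X ≡ true)

  Recursive : SysFun → Set
  Recursive F = ∀ X → ¬ TransClosure (Edge F) X X

  Compatible : Assignment → SysFun → Set
  Compatible s F = ∀ V → En F V ≡ true → s V ≡ fn F V s

  -- Interventions  X = x  : a nonempty list of equations (X_i , x_i)

  Eqs : Set
  Eqs = List⁺ (Σ Var Val)

  Consistent : Eqs → Set
  Consistent L = ∀ X (x y : Val X) →
    (X , x) ∈ toList L → (X , y) ∈ toList L → x ≡ y

  inVars : Var → List (Σ Var Val) → Bool
  inVars V []            = false
  inVars V ((X , _) ∷ L) = does (V ≟ X) ∨ inVars V L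

  restrict : Eqs → SysFun → SysFun
  restrict L F = record
    { En       = λ V → En F V ∧ not (inVars V (toList L))
    ; PA       = PA F
    ; PA-irr   = λ V e → PA-irr F V (∧-l e)
    ; fn       = fn F
    ; fn-local = fn-local F
    }
    where
      ∧-l : ∀ {a b} → a ∧ b ≡ true → a ≡ true
      ∧-l {true} _ = _≡_.refl

  -- s' = s_{X=x} (the recursive clauses, stated as the defining
  -- equations; for recursive F and consistent X=x there is exactly one
  -- such s').
  IsIntervened : Eqs → SysFun → Assignment → Assignment → Set
  IsIntervened L F s s' =
      (∀ X x → (X , x) ∈ toList L → s' X ≡ x)
    × (∀ V → inVars V (toList L) ≡ false → En F V ≡ false → s' V ≡ s V)
    × (∀ V → inVars V (toList L) ≡ false → En F V ≡ true → s' V ≡ fn F V s')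

  Pair : Set
  Pair = Assignment × SysFun

  Team : Set₁
  Team = Pair → Set

  IsGenCausalTeam : Team → Set
  IsGenCausalTeam T = ∀ p → T p → Recursive (proj₂ p) × Compatible (proj₁ p) (proj₂ p)

  singleton : Pair → Team
  singleton p q = q ≡ p

  intervene : Eqs → Team → Team
  intervene L T (s' , F') =
    ∃ λ (p : Pair) → T p × (F' ≡ restrict L (proj₂ p))
                         × IsIntervened L (proj₂ p) (proj₁ p) s'

  _≐_∪_ : Team → Team → Team → Set
  T ≐ T₁ ∪ T₂ = ∀ p → (T p → T₁ p ⊎ T₂ p) × (T₁ p ⊎ T₂ p → T p)

  data CO : Set where
    eq   : (X : Var) → Val X → CO
    ¬ᶜ   : CO → CO
    _∧ᶜ_ : CO → CO → CO
    _∨ᶜ_ : CO → CO → CO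
    _□→ᶜ_ : Eqs → CO → CO

  data COs : Set where
    eq   : (X : Var) → Val X → COs
    ¬ˢ   : CO → COs
    _∧ˢ_ : COs → COs → COs
    _∨ˢ_ : COs → COs → COs
    _⊔_  : COs → COs → COs
    _□→ˢ_ : Eqs → COs → COs

  _⊨ᶜ_ : Team → CO → Set₁
  T ⊨ᶜ eq X x    = Level.Lift (lsuc lzero) (∀ p → T p → proj₁ p X ≡ x)
  T ⊨ᶜ ¬ᶜ α      = ∀ p → T p → (singleton p ⊨ᶜ α → ⊥)
  T ⊨ᶜ (α ∧ᶜ β)  = (T ⊨ᶜ α) × (T ⊨ᶜ β)
  T ⊨ᶜ (α ∨ᶜ β)  = ∃ λ T₁ → ∃ λ T₂ → (T ≐ T₁ ∪ T₂) × (T₁ ⊨ᶜ α) × (T₂ ⊨ᶜ β)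
  T ⊨ᶜ (L □→ᶜ α) = Level.Lift (lsuc lzero) (¬ Consistent L) ⊎ (intervene L T ⊨ᶜ α)

  _⊨_ : Team → COs → Set₁
  T ⊨ eq X x    = Level.Lift (lsuc lzero) (∀ p → T p → proj₁ p X ≡ x)
  T ⊨ ¬ˢ α      = ∀ p → T p → (singleton p ⊨ᶜ α → ⊥)
  T ⊨ (φ ∧ˢ ψ)  = (T ⊨ φ) × (T ⊨ ψ)
  T ⊨ (φ ∨ˢ ψ)  = ∃ λ T₁ → ∃ λ T₂ → (T ≐ T₁ ∪ T₂) × (T₁ ⊨ φ) × (T₂ ⊨ ψ)
  T ⊨ (φ ⊔ ψ)   = (T ⊨ φ) ⊎ (T ⊨ ψ)
  T ⊨ (L □→ˢ φ) = Level.Lift (lsuc lzero) (¬ Consistent L) ⊎ (intervene L T ⊨ φ)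

  _⊨g_ : (CO → Set) → COs → Set₁
  Δ ⊨g φ = ∀ (T : Team) → IsGenCausalTeam T → (∀ α → Δ α → T ⊨ᶜ α) → T ⊨ φ

  ∅ : CO → Set
  ∅ _ = ⊥

  ⊨g_ : COs → Set₁
  ⊨g φ = ∅ ⊨g φ

module Submission where

-- Two structural facts about the logic drive the proof.
--  * Flatness of CO: a team satisfies a CO-formula iff every pair (s , F) of
--    it does, where pair-wise satisfaction `_⊩_` is the classical Boolean
--    semantics with counterfactuals evaluated by intervening on the pair.
--  * Downward closure of CO⊔: a formula true on a team is true on every
--    subteam.
-- Given Δ, consider the maximal model `maxModel Δ`: the team of all pairs
-- (s , F) with F recursive, s compatible with F and (s , F) ⊩ α for all α ∈ Δ.
-- By flatness it is a generalized causal team satisfying Δ, and every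
-- generalized causal team satisfying Δ is a subteam of it.  Hence, by
-- downward closure, Δ ⊨g φ holds iff `maxModel Δ ⊨ φ`.  Since a team
-- satisfies φ ⊔ ψ iff it satisfies φ or ψ, the theorem follows by
-- evaluating φ ⊔ ψ on the maximal model; the case Δ = ∅ is an instance.

open import Defs
open import Level using (lift; lower)
open import Data.Product using (_×_; _,_; proj₁; proj₂)
open import Data.Sum using (_⊎_; inj₁; inj₂; [_,_])
import Data.Sum as Sum
open import Data.Empty using (⊥-elim)
open import Relation.Nullary using (¬_)
open import Relation.Binary.PropositionalEquality using (_≡_; refl; sym; trans)

module _ (σ : Signature) where

  _⊩_ : Pair σ → CO σ → Set
  p ⊩ eq X x = proj₁ p X ≡ x
  p ⊩ ¬ᶜ α = ¬ (p ⊩ α)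
  p ⊩ (α ∧ᶜ β) = (p ⊩ α) × (p ⊩ β)
  p ⊩ (α ∨ᶜ β) = (p ⊩ α) ⊎ (p ⊩ β)
  (s , F) ⊩ (L □→ᶜ α) = ∀ s' → IsIntervened σ L F s s' → (s' , restrict σ L F) ⊩ α

  _⊩ᵀ_ : Team σ → CO σ → Set
  T ⊩ᵀ α = ∀ p → T p → p ⊩ α

  _⊆_ : Team σ → Team σ → Set
  T ⊆ T' = ∀ p → T p → T' p

  intervened⇒consistent : ∀ L F s s' → IsIntervened σ L F s s' → Consistent σ L
  intervened⇒consistent L F s s' (sets , _) X x y x∈L y∈L =
    trans (sym (sets X x x∈L)) (sets X y y∈L)

  flat⇒ : ∀ (T : Team σ) α → _⊨ᶜ_ σ T α → T ⊩ᵀ α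
  ⇒flat : ∀ (T : Team σ) α → T ⊩ᵀ α → _⊨ᶜ_ σ T α

  flat⇒ T (eq X x) h = lower h
  flat⇒ T (¬ᶜ α) h p Tp p⊩α =
    h p Tp (⇒flat (singleton σ p) α (λ { q refl → p⊩α }))
  flat⇒ T (α ∧ᶜ β) (hα , hβ) p Tp = flat⇒ T α hα p Tp , flat⇒ T β hβ p Tp
  flat⇒ T (α ∨ᶜ β) (T₁ , T₂ , T≐ , h₁ , h₂) p Tp =
    Sum.map (flat⇒ T₁ α h₁ p) (flat⇒ T₂ β h₂ p) (proj₁ (T≐ p) Tp)
  flat⇒ T (L □→ᶜ α) (inj₁ (lift inconsistent)) (s , F) Tp s' int =
    ⊥-elim (inconsistent (intervened⇒consistent L F s s' int))
  flat⇒ T (L □→ᶜ α) (inj₂ h) (s , F) Tp s' int =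
    flat⇒ (intervene σ L T) α h (s' , restrict σ L F) ((s , F) , Tp , refl , int)

  ⇒flat T (eq X x) h = lift h
  ⇒flat T (¬ᶜ α) h p Tp hα = h p Tp (flat⇒ (singleton σ p) α hα p refl)
  ⇒flat T (α ∧ᶜ β) h =
    ⇒flat T α (λ p Tp → proj₁ (h p Tp)) , ⇒flat T β (λ p Tp → proj₂ (h p Tp))
  ⇒flat T (α ∨ᶜ β) h =
    Tα , Tβ , split , ⇒flat Tα α (λ _ → proj₂) , ⇒flat Tβ β (λ _ → proj₂)
    where
      Tα Tβ : Team σ
      Tα p = T p × p ⊩ α
      Tβ p = T p × p ⊩ β
      split : _≐_∪_ σ T Tα Tβ
      split p = (λ Tp → Sum.map (Tp ,_) (Tp ,_) (h p Tp)) , [ proj₁ , proj₁ ]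
  ⇒flat T (L □→ᶜ α) h =
    inj₂ (⇒flat (intervene σ L T) α (λ { _ ((s , F) , Tp , refl , int) → h (s , F) Tp _ int }))

  intervene-mono : ∀ L {T T' : Team σ} → T ⊆ T' → intervene σ L T ⊆ intervene σ L T'
  intervene-mono L T⊆T' _ (p , Tp , F≡ , int) = p , T⊆T' p Tp , F≡ , int

  downward-closed : ∀ {T T' : Team σ} φ → T ⊆ T' → _⊨_ σ T' φ → _⊨_ σ T φ
  downward-closed (eq X x) T⊆T' h = lift (λ p Tp → lower h p (T⊆T' p Tp))
  downward-closed (¬ˢ α) T⊆T' h p Tp = h p (T⊆T' p Tp)
  downward-closed (φ ∧ˢ ψ) T⊆T' (hφ , hψ) =
    downward-closed φ T⊆T' hφ , downward-closed ψ T⊆T' hψ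
  downward-closed {T} (φ ∨ˢ ψ) T⊆T' (T₁ , T₂ , T'≐ , h₁ , h₂) =
    T∩T₁ , T∩T₂ , split ,
    downward-closed φ (λ _ → proj₂) h₁ , downward-closed ψ (λ _ → proj₂) h₂
    where
      T∩T₁ T∩T₂ : Team σ
      T∩T₁ p = T p × T₁ p
      T∩T₂ p = T p × T₂ p
      split : _≐_∪_ σ T T∩T₁ T∩T₂
      split p = (λ Tp → Sum.map (Tp ,_) (Tp ,_) (proj₁ (T'≐ p) (T⊆T' p Tp)))
              , [ proj₁ , proj₁ ]
  downward-closed (φ ⊔ ψ) T⊆T' =
    Sum.map (downward-closed φ T⊆T') (downward-closed ψ T⊆T')
  downward-closed (L □→ˢ φ) T⊆T' (inj₁ inconsistent) = inj₁ inconsistent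
  downward-closed (L □→ˢ φ) T⊆T' (inj₂ h) =
    inj₂ (downward-closed φ (intervene-mono L T⊆T') h)

  maxModel : (CO σ → Set) → Team σ
  maxModel Δ (s , F) = Recursive σ F × Compatible σ s F × (∀ α → Δ α → (s , F) ⊩ α)

  maxModel-causal : ∀ Δ → IsGenCausalTeam σ (maxModel Δ)
  maxModel-causal Δ _ (rec , compat , _) = rec , compat

  maxModel-satisfies : ∀ Δ α → Δ α → _⊨ᶜ_ σ (maxModel Δ) α
  maxModel-satisfies Δ α α∈Δ = ⇒flat (maxModel Δ) α (λ _ M → proj₂ (proj₂ M) α α∈Δ)

  maxModel-maximal : ∀ Δ (T : Team σ) → IsGenCausalTeam σ T →
                     (∀ α → Δ α → _⊨ᶜ_ σ T α) → T ⊆ maxModel Δ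
  maxModel-maximal Δ T causal T⊨Δ p Tp =
    proj₁ (causal p Tp) , proj₂ (causal p Tp) , λ α α∈Δ → flat⇒ T α (T⊨Δ α α∈Δ) p Tp

  maxModel⇒entails : ∀ Δ φ → _⊨_ σ (maxModel Δ) φ → _⊨g_ σ Δ φ
  maxModel⇒entails Δ φ h T causal T⊨Δ =
    downward-closed φ (maxModel-maximal Δ T causal T⊨Δ) h

  entails⇒maxModel : ∀ Δ φ → _⊨g_ σ Δ φ → _⊨_ σ (maxModel Δ) φ
  entails⇒maxModel Δ φ h = h (maxModel Δ) (maxModel-causal Δ) (maxModel-satisfies Δ)

  disjunction-property : (Δ : CO σ → Set) (φ ψ : COs σ) →
    _⊨g_ σ Δ (φ ⊔ ψ) → (_⊨g_ σ Δ φ) ⊎ (_⊨g_ σ Δ ψ)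
  disjunction-property Δ φ ψ h =
    Sum.map (maxModel⇒entails Δ φ) (maxModel⇒entails Δ ψ) (entails⇒maxModel Δ (φ ⊔ ψ) h)

theorem3p6 : ((σ : Signature) (Δ : CO σ → Set) (φ ψ : COs σ) →
    _⊨g_ σ Δ (φ ⊔ ψ) → (_⊨g_ σ Δ φ) ⊎ (_⊨g_ σ Δ ψ))
    × ((σ : Signature) (φ ψ : COs σ) →
    ⊨g_ σ (φ ⊔ ψ) → (⊨g_ σ φ) ⊎ (⊨g_ σ ψ))
theorem3p6 = disjunction-property , (λ σ → disjunction-property σ (∅ σ))
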